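{- Let $G=(V,E)$ be a graph, $k\in\mathbb{N}$, and let $I := \{v\in V : d_G(v)=0\}$ be the set of isolated vertices. Then $(G,k)$ is a yes-instance of \textsc{Cluster Vertex Splitting} if and only if $(G, |V|-|I|+k)$ is a yes-instance of \textsc{Sigma Clique Cover}.
   Context: Graphs are finite, simple, undirected. A \emph{cluster graph} is a graph in which every connected component is a clique. A \emph{vertex split} of $u\in V$ produces the graph with vertex set $(V\setminus\{u\})\cup\{v,w\}$ ($v,w$ new), keeping all edges not incident to $u$ and distributing the edges incident to $u$ among $v$ and $w$ so that the union of the new neighborhoods of $v,w$ equals $N_G(u)$. \textsc{Cluster Vertex Splitting}: given $(G,k)$, decide whether at most $k$ vertex splits transform $G$ into a cluster graph. A \emph{sigma clique cover} of $G$ is a set $\mathcal{C}$ of subsets of $V$ such that $G[C]$ is a clique for every $C\in\mathcal{C}$ and every edge of $G$ has both endpoints in some $C\in\mathcal{C}$; its weight is $\sum_{C\in\mathcal{C}}|C|$. \textsc{Sigma Clique Cover}: given $(G,s)$, decide whether $G$ has a sigma clique cover of weight at most $s$. -}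

module Defs where

open import Data.Nat using (ℕ; zero; suc; _+_; _≤_; _≡ᵇ_)
open import Data.Bool using (Bool; true; false; _∨_; if_then_else_)
open import Data.Fin using (Fin; inject₁; fromℕ)
open import Data.Fin.Subset using (Subset; _∈_; ∣_∣)
open import Data.List using (List; map; allFin)
open import Data.Nat.ListAction using (sum)
open import Data.List.Membership.Propositional renaming (_∈_ to _∈L_)
open import Data.Vec using (tabulate)
open import Data.Product using (Σ; ∃; ∃-syntax; _×_)
open import Relation.Nullary using (¬_)
open import Relation.Binary.PropositionalEquality using (_≡_)
open import Relation.Binary.Construct.Closure.ReflexiveTransitive using (Star)

record Graph (n : ℕ) : Set where
  field
    adj  : Fin n → Fin n → Bool
    sym  : ∀ i j → adj i j ≡ adj j i
    irr  : ∀ i → adj i i ≡ false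
open Graph public

Edge : ∀ {n} → Graph n → Fin n → Fin n → Set
Edge G i j = adj G i j ≡ true

Connected : ∀ {n} → Graph n → Fin n → Fin n → Set
Connected G = Star (Edge G)

IsCluster : ∀ {n} → Graph n → Set
IsCluster G = ∀ i j → ¬ (i ≡ j) → Connected G i j → Edge G i j

-- H is obtained from G by splitting vertex u.
-- In H (on Fin (suc n)), vertex inject₁ x (x ≠ u) is the old vertex x,
-- inject₁ u is the new vertex v and fromℕ n is the new vertex w.
record IsSplit {n} (G : Graph n) (u : Fin n) (H : Graph (suc n)) : Set where
  field
    keep   : ∀ x y → ¬ (x ≡ u) → ¬ (y ≡ u) →
             adj H (inject₁ x) (inject₁ y) ≡ adj G x y
    nbrs   : ∀ x → ¬ (x ≡ u) →
             (adj H (inject₁ u) (inject₁ x) ∨ adj H (fromℕ n) (inject₁ x)) ≡ adj G u x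
    vw     : adj H (inject₁ u) (fromℕ n) ≡ false

data SplitSeq : ∀ {n m} → Graph n → Graph m → ℕ → Set where
  done : ∀ {n} {G : Graph n} → SplitSeq G G 0
  step : ∀ {n m j} {G : Graph n} {G′ : Graph (suc n)} {H : Graph m} (u : Fin n) →
         IsSplit G u G′ → SplitSeq G′ H j → SplitSeq G H (suc j)

CVS : ∀ {n} → Graph n → ℕ → Set
CVS G k = ∃[ m ] ∃[ j ] Σ (Graph m) λ H → j ≤ k × SplitSeq G H j × IsCluster H

IsClique : ∀ {n} → Graph n → Subset n → Set
IsClique G C = ∀ i j → i ∈ C → j ∈ C → ¬ (i ≡ j) → Edge G i j

IsSigmaCliqueCover : ∀ {n} → Graph n → List (Subset n) → Set
IsSigmaCliqueCover G 𝒞 =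
  (∀ C → C ∈L 𝒞 → IsClique G C) ×
  (∀ i j → Edge G i j → ∃[ C ] (C ∈L 𝒞 × i ∈ C × j ∈ C))

weight : ∀ {n} → List (Subset n) → ℕ
weight 𝒞 = sum (map ∣_∣ 𝒞)

SCC : ∀ {n} → Graph n → ℕ → Set
SCC G s = ∃[ 𝒞 ] (IsSigmaCliqueCover G 𝒞 × weight 𝒞 ≤ s)

degree : ∀ {n} → Graph n → Fin n → ℕ
degree {n} G i = sum (map (λ j → if adj G i j then 1 else 0) (allFin n))

isolated : ∀ {n} → Graph n → Subset n
isolated G = tabulate (λ i → degree G i ≡ᵇ 0)

-- Call the non-isolated vertices active; there are n ∸ ∣ isolated G ∣ of them.  A cluster graph
-- is covered by its non-trivial components with weight exactly the number of active vertices; a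
-- cover of a graph obtained by a split projects back to a cover of no larger weight, and a split
-- creates at most one new active vertex.  Conversely, take a cover of weight at most the number
-- of active vertices plus k by cliques of size ≥ 2.  If no vertex lies in two of its cliques, the
-- graph is a cluster graph.  Otherwise counting the weight vertex by vertex shows k ≥ 1, and
-- splitting such a vertex x into one copy for one clique through x and one for all the others
-- gives a graph with one more active vertex and a cover of the same weight.
module Submission where

open import Defs
open import Data.Nat using (ℕ; zero; suc; _+_; _∸_; _≤_; _<_; z≤n; s≤s; _≤?_; _≡ᵇ_)
open import Data.Fin.Subset using (∣_∣; Subset; _∈_; _∉_; _⊆_; _-_; ⁅_⁆; ∁)
open import Data.Product using (_×_; ∃; _,_; proj₁; proj₂)

open import Data.Bool using (true; false; _∨_; if_then_else_)
import Data.Bool as Bool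
open import Data.Bool.Properties using (∨-zeroʳ; ⇔→≡)
open import Data.Fin using (Fin; Fin′; zero; suc; inject; inject₁; fromℕ; compare; less; equal; greater)
open import Data.Fin.Properties
  using (_≟_; any?; all?; ¬∀⟶∃¬-smallest; 0≢1+n; suc-injective; fromℕ≢inject₁; inject₁-injective)
open import Data.Fin.Subset.Properties
  using (_∈?_; ∣∁p∣≡n∸∣p∣; x∈∁p⇒x∉p; x∉p⇒x∈∁p; x∈p⇒∣p-x∣<∣p∣; x∈p∧x≢y⇒x∈p-y; p⊆q⇒∣p∣≤∣q∣;
         ∣⁅x⁆∣≡1; x∈⁅x⁆)
open import Data.List using (List; []; _∷_)
import Data.List as List
open import Data.List.Membership.Propositional using (find; lose) renaming (_∈_ to _∈L_)
open import Data.List.Membership.Propositional.Properties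
  using (∈-map⁺; ∈-map⁻; ∈-filter⁺; ∈-filter⁻; ∈-tabulate⁺; ∈-tabulate⁻)
open import Data.List.Properties using (map-tabulate; filter-accept; filter-reject)
open import Data.List.Relation.Binary.Permutation.Propositional
  using (_↭_; ↭-refl; ↭-sym; ↭-trans; ↭-prep; ↭-swap)
open import Data.List.Relation.Binary.Permutation.Propositional.Properties
  using (∈-resp-↭) renaming (map⁺ to ↭-map⁺)
import Data.List.Relation.Unary.Any as Any
open import Data.List.Relation.Unary.Any using (here; there)
open import Data.Nat.ListAction using (sum)
open import Data.Nat.ListAction.Properties using (sum-↭)
open import Data.Nat.Properties
  using (module ≤-Reasoning; ≤-reflexive; ≤-trans; ≤-antisym; <-≤-trans; <-irrefl; ≤-pred; ≰⇒>;
         +-comm; +-suc;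
         +-identityʳ; +-mono-≤; +-monoˡ-≤; +-monoʳ-≤; +-mono-<-≤; +-mono-≤-<; m≤m+n; m≤n+m;
         ≡ᵇ⇒≡; ≡⇒≡ᵇ; +-0-commutativeMonoid)
open import Algebra.Properties.CommutativeMonoid.Sum +-0-commutativeMonoid
  using (sum-syntax; sum-cong-≗; ∑-comm; ∑-distrib-+; sum-replicate-zero; sum-init-last)
open import Data.Sum using (_⊎_; inj₁; inj₂)
open import Data.Vec using ([]; _∷_; tabulate)
open import Data.Vec.Properties using (lookup∘tabulate; []=⇒lookup; lookup⇒[]=)
open import Function using (_∘_; id; mk⇔)
open import Relation.Binary.Construct.Closure.ReflexiveTransitive using (ε; _◅_; _◅◅_)
open import Relation.Binary.PropositionalEquality as ≡
  using (_≡_; _≢_; refl; cong; cong₂; module ≡-Reasoning)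
open import Relation.Nullary using (¬_; Dec; yes; no; does; contradiction)
open import Relation.Nullary.Decidable as Dec
  using (T?; _×-dec_; _⊎-dec_; ¬?; dec-true; dec-false; does-⇔; decidable-stable)
open import Relation.Unary using (Pred; Decidable)

-- Indicators and sums over Fin n

𝟙 : ∀ {p} {P : Set p} → Dec P → ℕ
𝟙 P? = if does P? then 1 else 0

𝟙≤1 : ∀ {p} {P : Set p} (P? : Dec P) → 𝟙 P? ≤ 1
𝟙≤1 (yes _) = s≤s z≤n
𝟙≤1 (no _)  = z≤n

𝟙-yes : ∀ {p} {P : Set p} (P? : Dec P) → P → 𝟙 P? ≡ 1
𝟙-yes (yes _) _ = refl
𝟙-yes (no ¬p) p = contradiction p ¬p

𝟙-no : ∀ {p} {P : Set p} (P? : Dec P) → ¬ P → 𝟙 P? ≡ 0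
𝟙-no (yes p) ¬p = contradiction p ¬p
𝟙-no (no _)  _  = refl

𝟙-mono : ∀ {p q} {P : Set p} {Q : Set q} (P? : Dec P) (Q? : Dec Q) → (P → Q) → 𝟙 P? ≤ 𝟙 Q?
𝟙-mono (yes p) Q? P⇒Q = ≤-reflexive (≡.sym (𝟙-yes Q? (P⇒Q p)))
𝟙-mono (no _)  Q? _   = z≤n

𝟙-cong : ∀ {p q} {P : Set p} {Q : Set q} (P? : Dec P) (Q? : Dec Q) → (P → Q) → (Q → P) →
         𝟙 P? ≡ 𝟙 Q?
𝟙-cong P? Q? P⇒Q Q⇒P = ≤-antisym (𝟙-mono P? Q? P⇒Q) (𝟙-mono Q? P? Q⇒P)

from-does : ∀ {p} {P : Set p} (P? : Dec P) → does P? ≡ true → P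
from-does (yes p) _ = p

∑-mono-≤ : ∀ {n} {f g : Fin n → ℕ} → (∀ i → f i ≤ g i) → ∑[ i < n ] f i ≤ ∑[ i < n ] g i
∑-mono-≤ {zero}  _   = z≤n
∑-mono-≤ {suc n} f≤g = +-mono-≤ (f≤g zero) (∑-mono-≤ (f≤g ∘ suc))

∑-mono-< : ∀ {n} {f g : Fin n → ℕ} {x} → (∀ i → f i ≤ g i) → f x < g x →
           ∑[ i < n ] f i < ∑[ i < n ] g i
∑-mono-< {suc n} {x = zero}  f≤g fx<gx = +-mono-<-≤ fx<gx (∑-mono-≤ (f≤g ∘ suc))
∑-mono-< {suc n} {x = suc x} f≤g fx<gx = +-mono-≤-< (f≤g zero) (∑-mono-< (f≤g ∘ suc) fx<gx)

≤-∑ : ∀ {n} (f : Fin n → ℕ) i → f i ≤ ∑[ j < n ] f j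
≤-∑ f zero    = m≤m+n (f zero) _
≤-∑ f (suc i) = ≤-trans (≤-∑ (f ∘ suc) i) (m≤n+m _ (f zero))

∑-zero : ∀ {n} {f : Fin n → ℕ} → (∀ i → f i ≡ 0) → ∑[ i < n ] f i ≡ 0
∑-zero {n} f≡0 = ≡.trans (sum-cong-≗ f≡0) (sum-replicate-zero n)

∑-single : ∀ {n} {f : Fin n → ℕ} x → (∀ i → i ≢ x → f i ≡ 0) → ∑[ i < n ] f i ≡ f x
∑-single {suc n} {f} zero f≡0 =
  ≡.trans (cong (f zero +_) (∑-zero (λ i → f≡0 (suc i) (0≢1+n ∘ ≡.sym)))) (+-identityʳ (f zero))
∑-single (suc x) f≡0 =
  cong₂ _+_ (f≡0 zero 0≢1+n) (∑-single x (λ i i≢x → f≡0 (suc i) (i≢x ∘ suc-injective)))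

∑-𝟙≤1 : ∀ {n p} {P : Pred (Fin n) p} (P? : Decidable P) → (∀ {i j} → P i → P j → i ≡ j) →
        ∑[ i < n ] 𝟙 (P? i) ≤ 1
∑-𝟙≤1 {zero}  P? unique = z≤n
∑-𝟙≤1 {suc n} P? unique with P? zero
... | yes p = s≤s (≤-reflexive (∑-zero (λ i → 𝟙-no (P? (suc i)) (0≢1+n ∘ unique p))))
... | no _  = ∑-𝟙≤1 (P? ∘ suc) (λ p q → suc-injective (unique p q))

𝟙-any≤∑ : ∀ {n p} {P : Pred (Fin n) p} (P? : Decidable P) → 𝟙 (any? P?) ≤ ∑[ i < n ] 𝟙 (P? i)
𝟙-any≤∑ P? with any? P?
... | yes (i , p) = ≤-trans (≤-reflexive (≡.sym (𝟙-yes (P? i) p))) (≤-∑ (𝟙 ∘ P?) i)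
... | no _        = z≤n

sum-tabulate : ∀ {n} (f : Fin n → ℕ) → sum (List.tabulate f) ≡ ∑[ i < n ] f i
sum-tabulate {zero}  f = refl
sum-tabulate {suc n} f = cong (f zero +_) (sum-tabulate (f ∘ suc))

setOf : ∀ {n p} {P : Pred (Fin n) p} → Decidable P → Subset n
setOf P? = tabulate (does ∘ P?)

module _ {n p} {P : Pred (Fin n) p} (P? : Decidable P) where

  ∈-setOf⁺ : ∀ {i} → P i → i ∈ setOf P?
  ∈-setOf⁺ {i} Pi = lookup⇒[]= i (setOf P?) (≡.trans (lookup∘tabulate (does ∘ P?) i) (dec-true (P? i) Pi))

  ∈-setOf⁻ : ∀ {i} → i ∈ setOf P? → P i
  ∈-setOf⁻ {i} i∈ = from-does (P? i) (≡.trans (≡.sym (lookup∘tabulate (does ∘ P?) i)) ([]=⇒lookup i∈))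

∣p∣≡∑𝟙 : ∀ {n} (p : Subset n) → ∣ p ∣ ≡ ∑[ i < n ] 𝟙 (i ∈? p)
∣p∣≡∑𝟙 []          = refl
∣p∣≡∑𝟙 (true ∷ p)  = cong suc (∣p∣≡∑𝟙 p)
∣p∣≡∑𝟙 (false ∷ p) = ∣p∣≡∑𝟙 p

∣setOf∣≡∑𝟙 : ∀ {n p} {P : Pred (Fin n) p} (P? : Decidable P) → ∣ setOf P? ∣ ≡ ∑[ i < n ] 𝟙 (P? i)
∣setOf∣≡∑𝟙 P? = ≡.trans (∣p∣≡∑𝟙 (setOf P?))
  (sum-cong-≗ (λ i → 𝟙-cong (i ∈? setOf P?) (P? i) (∈-setOf⁻ P?) (∈-setOf⁺ P?)))

∣p∣≤1+∣q∣ : ∀ {n} (p : Subset (suc n)) (q : Subset n) → (∀ {y} → inject₁ y ∈ p → y ∈ q) →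
            ∣ p ∣ ≤ suc ∣ q ∣
∣p∣≤1+∣q∣ {n} p q p⊆q = begin
  ∣ p ∣                                               ≡⟨ ∣p∣≡∑𝟙 p ⟩
  ∑[ a < suc n ] 𝟙 (a ∈? p)                           ≡⟨ sum-init-last (λ a → 𝟙 (a ∈? p)) ⟩
  ∑[ y < n ] 𝟙 (inject₁ y ∈? p) + 𝟙 (fromℕ n ∈? p)   ≤⟨ +-mono-≤ (∑-mono-≤ (λ y → 𝟙-mono (inject₁ y ∈? p) (y ∈? q) p⊆q))
                                                                 (𝟙≤1 (fromℕ n ∈? p)) ⟩
  ∑[ y < n ] 𝟙 (y ∈? q) + 1                           ≡⟨ +-comm _ 1 ⟩
  suc (∑[ y < n ] 𝟙 (y ∈? q))                         ≡⟨ cong suc (∣p∣≡∑𝟙 q) ⟨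
  suc ∣ q ∣                                           ∎
  where open ≤-Reasoning

1+∣q∣≤∣p∣ : ∀ {n} (p : Subset (suc n)) (q : Subset n) → (∀ {y} → y ∈ q → inject₁ y ∈ p) →
            fromℕ n ∈ p → suc ∣ q ∣ ≤ ∣ p ∣
1+∣q∣≤∣p∣ {n} p q q⊆p last∈p = begin
  suc ∣ q ∣                                           ≡⟨ cong suc (∣p∣≡∑𝟙 q) ⟩
  suc (∑[ y < n ] 𝟙 (y ∈? q))                         ≡⟨ +-comm 1 _ ⟩
  ∑[ y < n ] 𝟙 (y ∈? q) + 1                           ≤⟨ +-mono-≤ (∑-mono-≤ (λ y → 𝟙-mono (y ∈? q) (inject₁ y ∈? p) q⊆p))
                                                                 (≤-reflexive (≡.sym (𝟙-yes (fromℕ n ∈? p) last∈p))) ⟩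
  ∑[ y < n ] 𝟙 (inject₁ y ∈? p) + 𝟙 (fromℕ n ∈? p)   ≡⟨ sum-init-last (λ a → 𝟙 (a ∈? p)) ⟨
  ∑[ a < suc n ] 𝟙 (a ∈? p)                           ≡⟨ ∣p∣≡∑𝟙 p ⟨
  ∣ p ∣                                               ∎
  where open ≤-Reasoning

∈∈≢⇒2≤∣p∣ : ∀ {n} {p : Subset n} {x y} → x ∈ p → y ∈ p → x ≢ y → 2 ≤ ∣ p ∣
∈∈≢⇒2≤∣p∣ {p = p} {x} x∈p y∈p x≢y = begin
  2                ≤⟨ s≤s (≤-trans (s≤s z≤n) (x∈p⇒∣p-x∣<∣p∣ (x∈p∧x≢y⇒x∈p-y y∈p (x≢y ∘ ≡.sym)))) ⟩
  suc ∣ p - x ∣    ≤⟨ x∈p⇒∣p-x∣<∣p∣ x∈p ⟩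
  ∣ p ∣            ∎
  where open ≤-Reasoning

2≤∣p∣⇒∃≢ : ∀ {n} {p : Subset n} → 2 ≤ ∣ p ∣ → ∀ x → ∃ λ y → y ∈ p × y ≢ x
2≤∣p∣⇒∃≢ {p = p} 2≤∣p∣ x with any? (λ y → y ∈? p ×-dec ¬? (y ≟ x))
... | yes other = other
... | no ∄other =
  contradiction (≤-trans 2≤∣p∣ (≤-trans (p⊆q⇒∣p∣≤∣q∣ p⊆⁅x⁆) (≤-reflexive (∣⁅x⁆∣≡1 x)))) (<-irrefl refl)
  where
  p⊆⁅x⁆ : p ⊆ ⁅ x ⁆
  p⊆⁅x⁆ {y} y∈p =
    ≡.subst (_∈ ⁅ x ⁆) (≡.sym (decidable-stable (y ≟ x) (λ y≢x → ∄other (y , y∈p , y≢x)))) (x∈⁅x⁆ x)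

image : ∀ {m n} → (Fin m → Fin n) → Subset m → Subset n
image f C = setOf (λ b → any? (λ a → a ∈? C ×-dec f a ≟ b))

module _ {m n} (f : Fin m → Fin n) {C : Subset m} where

  ∈-image⁺ : ∀ {a} → a ∈ C → f a ∈ image f C
  ∈-image⁺ {a} a∈C = ∈-setOf⁺ (λ b → any? (λ a → a ∈? C ×-dec f a ≟ b)) (a , a∈C , refl)

  ∈-image⁻ : ∀ {b} → b ∈ image f C → ∃ λ a → a ∈ C × f a ≡ b
  ∈-image⁻ = ∈-setOf⁻ (λ b → any? (λ a → a ∈? C ×-dec f a ≟ b))

  ∣image∣≤∣p∣ : ∣ image f C ∣ ≤ ∣ C ∣
  ∣image∣≤∣p∣ = begin
    ∣ image f C ∣                                     ≡⟨ ∣setOf∣≡∑𝟙 (λ b → any? (λ a → a ∈? C ×-dec f a ≟ b)) ⟩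
    ∑[ b < n ] 𝟙 (any? (λ a → a ∈? C ×-dec f a ≟ b))  ≤⟨ ∑-mono-≤ (λ b → 𝟙-any≤∑ (λ a → a ∈? C ×-dec f a ≟ b)) ⟩
    ∑[ b < n ] ∑[ a < m ] 𝟙 (a ∈? C ×-dec f a ≟ b)    ≡⟨ ∑-comm (λ b a → 𝟙 (a ∈? C ×-dec f a ≟ b)) ⟩
    ∑[ a < m ] ∑[ b < n ] 𝟙 (a ∈? C ×-dec f a ≟ b)    ≡⟨ sum-cong-≗ (λ a → ∑-single (f a) (λ b b≢fa →
                                                           𝟙-no (a ∈? C ×-dec f a ≟ b) (b≢fa ∘ ≡.sym ∘ proj₂))) ⟩
    ∑[ a < m ] 𝟙 (a ∈? C ×-dec f a ≟ f a)            ≡⟨ sum-cong-≗ (λ a → 𝟙-cong (a ∈? C ×-dec f a ≟ f a) (a ∈? C)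
                                                                                     proj₁ (_, refl)) ⟩
    ∑[ a < m ] 𝟙 (a ∈? C)                             ≡⟨ ∣p∣≡∑𝟙 C ⟨
    ∣ C ∣                                             ∎
    where open ≤-Reasoning

-- Edges and active vertices

Edge-sym : ∀ {n} (G : Graph n) {i j} → Edge G i j → Edge G j i
Edge-sym G {i} {j} e = ≡.trans (sym G j i) e

Edge-irrefl : ∀ {n} (G : Graph n) {i j} → Edge G i j → i ≢ j
Edge-irrefl G {i} e refl = contradiction (≡.trans (≡.sym e) (irr G i)) λ ()

Edge? : ∀ {n} (G : Graph n) i j → Dec (Edge G i j)
Edge? G i j = adj G i j Bool.≟ true

degree≡∑𝟙 : ∀ {n} (G : Graph n) i → degree G i ≡ ∑[ j < n ] 𝟙 (Edge? G i j)
degree≡∑𝟙 {n} G i = begin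
  degree G i                      ≡⟨ cong sum (map-tabulate id indicator) ⟩
  sum (List.tabulate indicator)   ≡⟨ sum-tabulate indicator ⟩
  ∑[ j < n ] indicator j          ≡⟨ sum-cong-≗ (λ j → indicator≡𝟙 (adj G i j)) ⟩
  ∑[ j < n ] 𝟙 (Edge? G i j)      ∎
  where
  open ≡-Reasoning
  indicator : Fin n → ℕ
  indicator j = if adj G i j then 1 else 0
  indicator≡𝟙 : ∀ b → (if b then 1 else 0) ≡ 𝟙 (b Bool.≟ true)
  indicator≡𝟙 true  = refl
  indicator≡𝟙 false = refl

active : ∀ {n} → Graph n → Subset n
active G = ∁ (isolated G)

-- isolated G is definitionally setOf (λ i → T? (degree G i ≡ᵇ 0)).
module _ {n} (G : Graph n) {i : Fin n} where

  ∈-isolated⁺ : degree G i ≡ 0 → i ∈ isolated G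
  ∈-isolated⁺ deg≡0 = ∈-setOf⁺ (λ i → T? (degree G i ≡ᵇ 0)) (≡⇒≡ᵇ (degree G i) 0 deg≡0)

  ∈-isolated⁻ : i ∈ isolated G → degree G i ≡ 0
  ∈-isolated⁻ i∈ = ≡ᵇ⇒≡ (degree G i) 0 (∈-setOf⁻ (λ i → T? (degree G i ≡ᵇ 0)) i∈)

  ∈-active⁺ : ∀ {j} → Edge G i j → i ∈ active G
  ∈-active⁺ {j} e = x∉p⇒x∈∁p λ i∈ → contradiction (≤-trans 1≤degree (≤-reflexive (∈-isolated⁻ i∈))) λ ()
    where
    1≤degree : 1 ≤ degree G i
    1≤degree = begin
      1                           ≡⟨ 𝟙-yes (Edge? G i j) e ⟨
      𝟙 (Edge? G i j)             ≤⟨ ≤-∑ (𝟙 ∘ Edge? G i) j ⟩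
      ∑[ k < n ] 𝟙 (Edge? G i k)  ≡⟨ degree≡∑𝟙 G i ⟨
      degree G i                  ∎
      where open ≤-Reasoning

  ∈-active⁻ : i ∈ active G → ∃ (Edge G i)
  ∈-active⁻ i∈ with any? (Edge? G i)
  ... | yes nbr = nbr
  ... | no ∄nbr = contradiction (∈-isolated⁺ deg≡0) (x∈∁p⇒x∉p i∈)
    where
    deg≡0 : degree G i ≡ 0
    deg≡0 = ≡.trans (degree≡∑𝟙 G i) (∑-zero (λ j → 𝟙-no (Edge? G i j) (∄nbr ∘ (j ,_))))

-- Sigma clique covers

Together : ∀ {n} → List (Subset n) → Fin n → Fin n → Set
Together 𝒞 i j = ∃ λ C → C ∈L 𝒞 × i ∈ C × j ∈ C

together? : ∀ {n} (𝒞 : List (Subset n)) i j → Dec (Together 𝒞 i j)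
together? 𝒞 i j =
  Dec.map′ find (λ { (C , C∈ , i∈×j∈) → lose C∈ i∈×j∈ }) (Any.any? (λ C → i ∈? C ×-dec j ∈? C) 𝒞)

Linked : ∀ {n} → List (Subset n) → Fin n → Fin n → Set
Linked 𝒞 i j = i ≢ j × Together 𝒞 i j

linked? : ∀ {n} (𝒞 : List (Subset n)) i j → Dec (Linked 𝒞 i j)
linked? 𝒞 i j = ¬? (i ≟ j) ×-dec together? 𝒞 i j

Linked⇒Edge : ∀ {n} {G : Graph n} {𝒞 i j} → IsSigmaCliqueCover G 𝒞 → Linked 𝒞 i j → Edge G i j
Linked⇒Edge (cliques , _) (i≢j , C , C∈ , i∈ , j∈) = cliques C C∈ _ _ i∈ j∈ i≢j

graphCoveredBy : ∀ {n} → List (Subset n) → Graph n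
graphCoveredBy 𝒞 = record
  { adj = λ i j → does (linked? 𝒞 i j)
  ; sym = λ i j → does-⇔ (mk⇔ flip-link flip-link) (linked? 𝒞 i j) (linked? 𝒞 j i)
  ; irr = λ i → dec-false (linked? 𝒞 i i) (λ (i≢i , _) → i≢i refl)
  }
  where
  flip-link : ∀ {i j} → Linked 𝒞 i j → Linked 𝒞 j i
  flip-link (i≢j , C , C∈ , i∈ , j∈) = i≢j ∘ ≡.sym , C , C∈ , j∈ , i∈

module _ {n} {𝒞 : List (Subset n)} {i j : Fin n} where

  graphCoveredBy-Edge⁺ : i ≢ j → Together 𝒞 i j → Edge (graphCoveredBy 𝒞) i j
  graphCoveredBy-Edge⁺ i≢j together = dec-true (linked? 𝒞 i j) (i≢j , together)

  graphCoveredBy-Edge⁻ : Edge (graphCoveredBy 𝒞) i j → Linked 𝒞 i j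
  graphCoveredBy-Edge⁻ = from-does (linked? 𝒞 i j)

graphCoveredBy-cover : ∀ {n} (𝒞 : List (Subset n)) → IsSigmaCliqueCover (graphCoveredBy 𝒞) 𝒞
graphCoveredBy-cover 𝒞 =
  (λ C C∈ i j i∈ j∈ i≢j → graphCoveredBy-Edge⁺ i≢j (C , C∈ , i∈ , j∈)) ,
  (λ i j e → proj₂ (graphCoveredBy-Edge⁻ e))

SCC-mono : ∀ {n} (G : Graph n) {s t} → s ≤ t → SCC G s → SCC G t
SCC-mono G s≤t (𝒞 , cover , weight≤s) = 𝒞 , cover , ≤-trans weight≤s s≤t

cover-↭ : ∀ {n} {G : Graph n} {𝒞 𝒟} → 𝒞 ↭ 𝒟 → IsSigmaCliqueCover G 𝒞 → IsSigmaCliqueCover G 𝒟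
cover-↭ 𝒞↭𝒟 (cliques , covers) =
  (λ C C∈ → cliques C (∈-resp-↭ (↭-sym 𝒞↭𝒟) C∈)) ,
  (λ i j e → let C , C∈ , i∈ , j∈ = covers i j e in C , ∈-resp-↭ 𝒞↭𝒟 C∈ , i∈ , j∈)

weight-↭ : ∀ {n} {𝒞 𝒟 : List (Subset n)} → 𝒞 ↭ 𝒟 → weight 𝒞 ≡ weight 𝒟
weight-↭ 𝒞↭𝒟 = sum-↭ (↭-map⁺ ∣_∣ 𝒞↭𝒟)

weight-map-≤ : ∀ {m n} (f : Subset m → Subset n) → (∀ C → ∣ f C ∣ ≤ ∣ C ∣) →
               ∀ 𝒞 → weight (List.map f 𝒞) ≤ weight 𝒞
weight-map-≤ f ∣f∣≤ []      = z≤n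
weight-map-≤ f ∣f∣≤ (C ∷ 𝒞) = +-mono-≤ (∣f∣≤ C) (weight-map-≤ f ∣f∣≤ 𝒞)

SCC-image : ∀ {m n} {H : Graph m} {G : Graph n} (f : Fin m → Fin n) →
            (∀ {a b} → Edge H a b → Edge G (f a) (f b)) →
            (∀ {i j} → Edge G i j → ∃ λ a → ∃ λ b → f a ≡ i × f b ≡ j × Edge H a b) →
            ∀ {s} → SCC H s → SCC G s
SCC-image {G = G} f hom lift (𝒞 , (cliques , covers) , weight≤s) =
  List.map (image f) 𝒞 , (cliques′ , covers′) ,
  ≤-trans (weight-map-≤ (image f) (λ C → ∣image∣≤∣p∣ f) 𝒞) weight≤s
  where
  cliques′ : ∀ C′ → C′ ∈L List.map (image f) 𝒞 → IsClique G C′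
  cliques′ _ C′∈ i j i∈ j∈ i≢j with ∈-map⁻ (image f) C′∈
  ... | C , C∈ , refl with ∈-image⁻ f i∈ | ∈-image⁻ f j∈
  ...   | a , a∈ , refl | b , b∈ , refl = hom (cliques C C∈ a b a∈ b∈ (i≢j ∘ cong f))
  covers′ : ∀ i j → Edge G i j → Together (List.map (image f) 𝒞) i j
  covers′ i j e with lift e
  ... | a , b , refl , refl , e′ = let C , C∈ , a∈ , b∈ = covers a b e′ in
    image f C , ∈-map⁺ (image f) C∈ , ∈-image⁺ f a∈ , ∈-image⁺ f b∈

Large : ∀ {n} → Subset n → Set
Large C = 2 ≤ ∣ C ∣

large : ∀ {n} → List (Subset n) → List (Subset n)
large = List.filter (λ C → 2 ≤? ∣ C ∣)

weight-large : ∀ {n} (𝒞 : List (Subset n)) → weight (large 𝒞) ≤ weight 𝒞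
weight-large []      = z≤n
weight-large (C ∷ 𝒞) = by-size (2 ≤? ∣ C ∣)
  where
  by-size : Dec (Large C) → weight (large (C ∷ 𝒞)) ≤ weight (C ∷ 𝒞)
  by-size (yes large-C) = ≤-trans (≤-reflexive (cong weight (filter-accept (λ C → 2 ≤? ∣ C ∣) {C} {𝒞} large-C)))
                                  (+-monoʳ-≤ ∣ C ∣ (weight-large 𝒞))
  by-size (no small-C)  = ≤-trans (≤-reflexive (cong weight (filter-reject (λ C → 2 ≤? ∣ C ∣) {C} {𝒞} small-C)))
                                  (≤-trans (weight-large 𝒞) (m≤n+m _ ∣ C ∣))

large-cover : ∀ {n} {G : Graph n} {𝒞} → IsSigmaCliqueCover G 𝒞 → IsSigmaCliqueCover G (large 𝒞)
large-cover {G = G} {𝒞} (cliques , covers) =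
  (λ C C∈ → cliques C (proj₁ (∈-filter⁻ (λ C → 2 ≤? ∣ C ∣) {xs = 𝒞} C∈))) ,
  (λ i j e → let C , C∈ , i∈ , j∈ = covers i j e in
             C , ∈-filter⁺ (λ C → 2 ≤? ∣ C ∣) C∈ (∈∈≢⇒2≤∣p∣ i∈ j∈ (Edge-irrefl G e)) , i∈ , j∈)

∈-large⇒Large : ∀ {n} {𝒞 : List (Subset n)} {C} → C ∈L large 𝒞 → Large C
∈-large⇒Large {𝒞 = 𝒞} = proj₂ ∘ ∈-filter⁻ (λ C → 2 ≤? ∣ C ∣) {xs = 𝒞}

occurrences : ∀ {n} → List (Subset n) → Fin n → ℕ
occurrences 𝒞 x = sum (List.map (λ C → 𝟙 (x ∈? C)) 𝒞)

weight≡∑occurrences : ∀ {n} (𝒞 : List (Subset n)) → weight 𝒞 ≡ ∑[ x < n ] occurrences 𝒞 x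
weight≡∑occurrences {n} []      = ≡.sym (sum-replicate-zero n)
weight≡∑occurrences     (C ∷ 𝒞) = ≡.trans (cong₂ _+_ (∣p∣≡∑𝟙 C) (weight≡∑occurrences 𝒞))
                                          (≡.sym (∑-distrib-+ (λ x → 𝟙 (x ∈? C)) (occurrences 𝒞)))

module _ {n} {x : Fin n} where

  1≤occurrences : ∀ {𝒞 C} → C ∈L 𝒞 → x ∈ C → 1 ≤ occurrences 𝒞 x
  1≤occurrences {C ∷ 𝒞} (here refl) x∈C = ≤-trans (≤-reflexive (≡.sym (𝟙-yes (x ∈? C) x∈C))) (m≤m+n _ _)
  1≤occurrences {D ∷ 𝒞} (there C∈)  x∈C = ≤-trans (1≤occurrences C∈ x∈C) (m≤n+m _ (𝟙 (x ∈? D)))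

  1≤occurrences⁻ : ∀ 𝒞 → 1 ≤ occurrences 𝒞 x → ∃ λ C → C ∈L 𝒞 × x ∈ C
  1≤occurrences⁻ (C ∷ 𝒞) 1≤occ with x ∈? C
  ... | yes x∈C = C , here refl , x∈C
  ... | no _    = let D , D∈ , x∈D = 1≤occurrences⁻ 𝒞 1≤occ in D , there D∈ , x∈D

  occurrences≤1⇒unique : ∀ {𝒞 C D} → occurrences 𝒞 x ≤ 1 → C ∈L 𝒞 → D ∈L 𝒞 → x ∈ C → x ∈ D → C ≡ D
  occurrences≤1⇒unique         occ≤1 (here refl) (here refl) x∈C x∈D = refl
  occurrences≤1⇒unique {C ∷ 𝒞} occ≤1 (here refl) (there D∈)  x∈C x∈D = contradiction
    (≤-trans (+-mono-≤ (≤-reflexive (≡.sym (𝟙-yes (x ∈? C) x∈C))) (1≤occurrences D∈ x∈D)) occ≤1) (<-irrefl refl)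
  occurrences≤1⇒unique {D ∷ 𝒞} occ≤1 (there C∈)  (here refl) x∈C x∈D = contradiction
    (≤-trans (+-mono-≤ (≤-reflexive (≡.sym (𝟙-yes (x ∈? D) x∈D))) (1≤occurrences C∈ x∈C)) occ≤1) (<-irrefl refl)
  occurrences≤1⇒unique {E ∷ 𝒞} occ≤1 (there C∈)  (there D∈)  x∈C x∈D =
    occurrences≤1⇒unique (≤-trans (m≤n+m _ (𝟙 (x ∈? E))) occ≤1) C∈ D∈ x∈C x∈D

  2≤occurrences⇒↭ : ∀ 𝒞 → 2 ≤ occurrences 𝒞 x →
           ∃ λ C → ∃ λ R → 𝒞 ↭ C ∷ R × x ∈ C × ∃ λ D → D ∈L R × x ∈ D
  2≤occurrences⇒↭ (C ∷ 𝒞) 2≤occ with x ∈? C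
  ... | yes x∈C = C , 𝒞 , ↭-refl , x∈C , 1≤occurrences⁻ 𝒞 (≤-pred 2≤occ)
  ... | no _    = let C₁ , R , 𝒞↭ , x∈C₁ , D , D∈ , x∈D = 2≤occurrences⇒↭ 𝒞 2≤occ in
                  C₁ , C ∷ R , ↭-trans (↭-prep C 𝒞↭) (↭-swap C C₁ ↭-refl) , x∈C₁ , D , there D∈ , x∈D

module _ {n} {G : Graph n} {𝒞 : List (Subset n)} (cover : IsSigmaCliqueCover G 𝒞) where

  Connected⇒Together : (∀ x → occurrences 𝒞 x ≤ 1) → ∀ {i j} → Connected G i j → i ≡ j ⊎ Together 𝒞 i j
  Connected⇒Together occ≤1 ε = inj₁ refl
  Connected⇒Together occ≤1 (_◅_ {j = k} e path) with proj₂ cover _ _ e | Connected⇒Together occ≤1 path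
  ... | together         | inj₁ refl = inj₂ together
  ... | C , C∈ , i∈ , k∈ | inj₂ (D , D∈ , k∈D , j∈) =
    inj₂ (C , C∈ , i∈ , ≡.subst (_ ∈_) (≡.sym (occurrences≤1⇒unique (occ≤1 k) C∈ D∈ k∈ k∈D)) j∈)

  cover⇒cluster : (∀ x → occurrences 𝒞 x ≤ 1) → IsCluster G
  cover⇒cluster occ≤1 i j i≢j path with Connected⇒Together occ≤1 path
  ... | inj₁ i≡j                 = contradiction i≡j i≢j
  ... | inj₂ (C , C∈ , i∈ , j∈) = proj₁ cover C C∈ i j i∈ j∈ i≢j

  ∣active∣<weight : ∀ {x} → 2 ≤ occurrences 𝒞 x → ∣ active G ∣ < weight 𝒞
  ∣active∣<weight {x} 2≤occ = begin-strict
    ∣ active G ∣                    ≡⟨ ∣p∣≡∑𝟙 (active G) ⟩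
    ∑[ y < n ] 𝟙 (y ∈? active G)    <⟨ ∑-mono-< {x = x} active≤occurrences
                                                     (≤-trans (s≤s (𝟙≤1 (x ∈? active G))) 2≤occ) ⟩
    ∑[ y < n ] occurrences 𝒞 y      ≡⟨ weight≡∑occurrences 𝒞 ⟨
    weight 𝒞                        ∎
    where
    open ≤-Reasoning
    active≤occurrences : ∀ y → 𝟙 (y ∈? active G) ≤ occurrences 𝒞 y
    active≤occurrences y with y ∈? active G
    ... | no _   = z≤n
    ... | yes y∈ = let z , e = ∈-active⁻ G y∈ ; C , C∈ , y∈C , _ = proj₂ cover y z e in
                   1≤occurrences {x = y} C∈ y∈C

-- Cluster graphs

Close : ∀ {n} → Graph n → Fin n → Fin n → Set
Close G a b = a ≡ b ⊎ Edge G a b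

module _ {n} (G : Graph n) where

  close? : ∀ a b → Dec (Close G a b)
  close? a b = a ≟ b ⊎-dec Edge? G a b

  Close-sym : ∀ {a b} → Close G a b → Close G b a
  Close-sym (inj₁ refl) = inj₁ refl
  Close-sym (inj₂ e)    = inj₂ (Edge-sym G e)

  Close⇒Connected : ∀ {a b} → Close G a b → Connected G a b
  Close⇒Connected (inj₁ refl) = ε
  Close⇒Connected (inj₂ e)    = e ◅ ε

  Close-active : ∀ {a b} → Close G a b → b ∈ active G → a ∈ active G
  Close-active (inj₁ refl) b∈ = b∈
  Close-active (inj₂ e)    _  = ∈-active⁺ G e

module _ {n} (G : Graph n) (cluster : IsCluster G) where

  Close-trans : ∀ {a b c} → Close G a b → Close G b c → Close G a c
  Close-trans {a} {b} {c} ab bc with a ≟ c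
  ... | yes a≡c = inj₁ a≡c
  ... | no a≢c  = inj₂ (cluster a c a≢c (Close⇒Connected G ab ◅◅ Close⇒Connected G bc))

  Leader : Fin n → Set
  Leader a = a ∈ active G × ((j : Fin′ a) → ¬ Close G a (inject j))

  leader? : ∀ a → Dec (Leader a)
  leader? a = a ∈? active G ×-dec all? (λ j → ¬? (close? G a (inject j)))

  leader-unique : ∀ {a a′ b} → Leader a → Leader a′ → Close G a b → Close G a′ b → a ≡ a′
  leader-unique {a} {a′} (_ , minimal) (_ , minimal′) ab a′b with compare a a′
  ... | less _ j    = contradiction (Close-trans a′b (Close-sym G ab)) (minimal′ j)
  ... | greater _ j = contradiction (Close-trans ab (Close-sym G a′b)) (minimal j)
  ... | equal _     = refl

  leader-exists : ∀ {b} → b ∈ active G → ∃ λ a → Leader a × Close G a b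
  leader-exists {b} b∈
    with ¬∀⟶∃¬-smallest n (λ c → ¬ Close G b c) (λ c → ¬? (close? G b c)) (λ ∀¬close → ∀¬close b (inj₁ refl))
  ... | a , ¬¬ba , below = a , (Close-active G ab b∈ , λ j aj → below j (Close-trans ba aj)) , ab
    where
    ba : Close G b a
    ba = decidable-stable (close? G b a) ¬¬ba
    ab : Close G a b
    ab = Close-sym G ba

  -- block a is the component of a when a is its least vertex and empty otherwise,
  -- so every active vertex lies in exactly one block.
  InBlock : Fin n → Fin n → Set
  InBlock a b = Leader a × Close G a b

  inBlock? : ∀ a b → Dec (InBlock a b)
  inBlock? a b = leader? a ×-dec close? G a b

  block : Fin n → Subset n
  block a = setOf (inBlock? a)

  blocks : List (Subset n)
  blocks = List.tabulate block

  blocks-cover : IsSigmaCliqueCover G blocks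
  blocks-cover = cliques , covers
    where
    cliques : ∀ C → C ∈L blocks → IsClique G C
    cliques C C∈ i j i∈ j∈ i≢j with ∈-tabulate⁻ C∈
    ... | a , refl
      with Close-trans (Close-sym G (proj₂ (∈-setOf⁻ (inBlock? a) i∈))) (proj₂ (∈-setOf⁻ (inBlock? a) j∈))
    ...   | inj₁ i≡j = contradiction i≡j i≢j
    ...   | inj₂ e   = e
    covers : ∀ i j → Edge G i j → Together blocks i j
    covers i j e = let a , leader , ai = leader-exists (∈-active⁺ G e) in
      block a , ∈-tabulate⁺ a , ∈-setOf⁺ (inBlock? a) (leader , ai) ,
      ∈-setOf⁺ (inBlock? a) (leader , Close-trans ai (inj₂ e))

  weight-blocks : weight blocks ≤ ∣ active G ∣
  weight-blocks = begin
    weight blocks                             ≡⟨ cong sum (map-tabulate block ∣_∣) ⟩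
    sum (List.tabulate (∣_∣ ∘ block))         ≡⟨ sum-tabulate (∣_∣ ∘ block) ⟩
    ∑[ a < n ] ∣ block a ∣                    ≡⟨ sum-cong-≗ (λ a → ∣setOf∣≡∑𝟙 (inBlock? a)) ⟩
    ∑[ a < n ] ∑[ b < n ] 𝟙 (inBlock? a b)    ≡⟨ ∑-comm (λ a b → 𝟙 (inBlock? a b)) ⟩
    ∑[ b < n ] ∑[ a < n ] 𝟙 (inBlock? a b)    ≤⟨ ∑-mono-≤ blocks∋≤1 ⟩
    ∑[ b < n ] 𝟙 (b ∈? active G)              ≡⟨ ∣p∣≡∑𝟙 (active G) ⟨
    ∣ active G ∣                              ∎
    where
    open ≤-Reasoning
    blocks∋≤1 : ∀ b → ∑[ a < n ] 𝟙 (inBlock? a b) ≤ 𝟙 (b ∈? active G)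
    blocks∋≤1 b with b ∈? active G
    ... | yes _ = ∑-𝟙≤1 (λ a → inBlock? a b) (λ (la , ab) (la′ , a′b) → leader-unique la la′ ab a′b)
    ... | no b∉ = ≤-reflexive (∑-zero (λ a → 𝟙-no (inBlock? a b)
                                         (λ (la , ab) → b∉ (Close-active G (Close-sym G ab) (proj₁ la)))))

  cluster⇒SCC : SCC G ∣ active G ∣
  cluster⇒SCC = blocks , blocks-cover , weight-blocks

-- Projecting a cover along a vertex split

∨-true⁺ : ∀ {a b} → a ≡ true ⊎ b ≡ true → a ∨ b ≡ true
∨-true⁺     (inj₁ refl) = refl
∨-true⁺ {a} (inj₂ refl) = ∨-zeroʳ a

∨-true⁻ : ∀ {a b} → a ∨ b ≡ true → a ≡ true ⊎ b ≡ true
∨-true⁻ {true}  _ = inj₁ refl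
∨-true⁻ {false} e = inj₂ e

data OldOrNew {n} : Fin (suc n) → Set where
  old : (y : Fin n) → OldOrNew (inject₁ y)
  new : OldOrNew (fromℕ n)

oldOrNew : ∀ {n} (a : Fin (suc n)) → OldOrNew a
oldOrNew {zero}  zero    = new
oldOrNew {suc n} zero    = old zero
oldOrNew {suc n} (suc a) with oldOrNew a
... | old y = old (suc y)
... | new   = new

oldOrNew-inject₁ : ∀ {n} (y : Fin n) → oldOrNew (inject₁ y) ≡ old y
oldOrNew-inject₁ zero    = refl
oldOrNew-inject₁ (suc y) rewrite oldOrNew-inject₁ y = refl

oldOrNew-fromℕ : ∀ n → oldOrNew (fromℕ n) ≡ new
oldOrNew-fromℕ zero    = refl
oldOrNew-fromℕ (suc n) rewrite oldOrNew-fromℕ n = refl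

module SplitProjection {n} {G : Graph n} {u : Fin n} {G′ : Graph (suc n)} (split : IsSplit G u G′) where
  open IsSplit split

  originOf : ∀ {a : Fin (suc n)} → OldOrNew a → Fin n
  originOf (old y) = y
  originOf new     = u

  origin : Fin (suc n) → Fin n
  origin a = originOf (oldOrNew a)

  origin-inject₁ : ∀ y → origin (inject₁ y) ≡ y
  origin-inject₁ y = cong originOf (oldOrNew-inject₁ y)

  origin-fromℕ : origin (fromℕ n) ≡ u
  origin-fromℕ = cong originOf (oldOrNew-fromℕ n)

  copy-edge⁻ : ∀ {z} → z ≢ u → Edge G′ (inject₁ u) (inject₁ z) ⊎ Edge G′ (fromℕ n) (inject₁ z) → Edge G u z
  copy-edge⁻ z≢u e = ≡.trans (≡.sym (nbrs _ z≢u)) (∨-true⁺ e)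

  copy-edge⁺ : ∀ {z} → z ≢ u → Edge G u z → ∃ λ c → origin c ≡ u × Edge G′ c (inject₁ z)
  copy-edge⁺ z≢u e with ∨-true⁻ (≡.trans (nbrs _ z≢u) e)
  ... | inj₁ e′ = inject₁ u , origin-inject₁ u , e′
  ... | inj₂ e′ = fromℕ n , origin-fromℕ , e′

  ¬Edge-copies : ¬ Edge G′ (fromℕ n) (inject₁ u)
  ¬Edge-copies e = contradiction (≡.trans (≡.sym e) (≡.trans (sym G′ _ _) vw)) λ ()

  old-edge : ∀ {y z} → Edge G′ (inject₁ y) (inject₁ z) → Edge G y z
  old-edge {y} {z} e with y ≟ u | z ≟ u
  ... | no y≢u   | no z≢u   = ≡.trans (≡.sym (keep y z y≢u z≢u)) e
  ... | yes refl | no z≢u   = copy-edge⁻ z≢u (inj₁ e)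
  ... | no y≢u   | yes refl = Edge-sym G (copy-edge⁻ y≢u (inj₁ (Edge-sym G′ e)))
  ... | yes refl | yes refl = contradiction refl (Edge-irrefl G′ e)

  new-edge : ∀ {z} → Edge G′ (fromℕ n) (inject₁ z) → Edge G u z
  new-edge {z} e with z ≟ u
  ... | no z≢u   = copy-edge⁻ z≢u (inj₂ e)
  ... | yes refl = contradiction e ¬Edge-copies

  origin-hom : ∀ {a b} → Edge G′ a b → Edge G (origin a) (origin b)
  origin-hom {a} {b} e with oldOrNew a | oldOrNew b
  ... | old _ | old _ = old-edge e
  ... | old _ | new   = Edge-sym G (new-edge (Edge-sym G′ e))
  ... | new   | old _ = new-edge e
  ... | new   | new   = contradiction refl (Edge-irrefl G′ e)

  origin-lift : ∀ {i j} → Edge G i j → ∃ λ a → ∃ λ b → origin a ≡ i × origin b ≡ j × Edge G′ a b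
  origin-lift {i} {j} e with i ≟ u | j ≟ u
  ... | no i≢u   | no j≢u   = inject₁ i , inject₁ j , origin-inject₁ i , origin-inject₁ j , ≡.trans (keep i j i≢u j≢u) e
  ... | yes refl | no j≢u   = let c , c↦u , e′ = copy-edge⁺ j≢u e in
                              c , inject₁ j , c↦u , origin-inject₁ j , e′
  ... | no i≢u   | yes refl = let c , c↦u , e′ = copy-edge⁺ i≢u (Edge-sym G e) in
                              inject₁ i , c , origin-inject₁ i , c↦u , Edge-sym G′ e′
  ... | yes refl | yes refl = contradiction refl (Edge-irrefl G e)

  SCC-project : ∀ {s} → SCC G′ s → SCC G s
  SCC-project = SCC-image {H = G′} {G = G} origin origin-hom origin-lift

  ∣active′∣≤1+∣active∣ : ∣ active G′ ∣ ≤ suc ∣ active G ∣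
  ∣active′∣≤1+∣active∣ = ∣p∣≤1+∣q∣ (active G′) (active G) λ y∈ →
    let _ , e = ∈-active⁻ G′ y∈ in ∈-active⁺ G (old-edge-origin e)
    where
    old-edge-origin : ∀ {y b} → Edge G′ (inject₁ y) b → Edge G y (origin b)
    old-edge-origin {y} e = ≡.subst (λ a → Edge G a _) (origin-inject₁ y) (origin-hom e)

  inject₁-active : ∀ {y} → y ≢ u → y ∈ active G → inject₁ y ∈ active G′
  inject₁-active {y} y≢u y∈ with ∈-active⁻ G y∈
  ... | z , e with z ≟ u
  ...   | no z≢u   = ∈-active⁺ G′ (≡.trans (keep y z y≢u z≢u) e)
  ...   | yes refl = let _ , _ , e′ = copy-edge⁺ y≢u (Edge-sym G e) in ∈-active⁺ G′ (Edge-sym G′ e′)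

splits⇒SCC : ∀ {n m j} {G : Graph n} {H : Graph m} → SplitSeq G H j → IsCluster H → SCC G (∣ active G ∣ + j)
splits⇒SCC {G = G} done cluster = SCC-mono G (≤-reflexive (≡.sym (+-identityʳ _))) (cluster⇒SCC G cluster)
splits⇒SCC {j = suc j} {G} (step {G′ = G′} u split splits) cluster =
  SCC-project (SCC-mono G′ bound (splits⇒SCC splits cluster))
  where
  open SplitProjection split
  bound : ∣ active G′ ∣ + j ≤ ∣ active G ∣ + suc j
  bound = ≤-trans (+-monoˡ-≤ j ∣active′∣≤1+∣active∣) (≤-reflexive (≡.sym (+-suc ∣ active G ∣ j)))

CVS⇒SCC : ∀ {n} (G : Graph n) k → CVS G k → SCC G (∣ active G ∣ + k)
CVS⇒SCC G k (_ , j , _ , j≤k , splits , cluster) =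
  SCC-mono G (+-monoʳ-≤ ∣ active G ∣ j≤k) (splits⇒SCC splits cluster)

-- Splitting a vertex along a cover

-- x is split into v = inject₁ x, which keeps the clique C₁, and w = fromℕ n, which takes over x in
-- the cliques of R; the new graph is the one covered by the images of these cliques.
module SplitAlong {n} (G : Graph n) (x : Fin n) (C₁ : Subset n) (R : List (Subset n))
                  (cover : IsSigmaCliqueCover G (C₁ ∷ R)) (x∈C₁ : x ∈ C₁) where

  ι : Fin n → Fin (suc n)
  ι y with y ≟ x
  ... | yes _ = fromℕ n
  ... | no _  = inject₁ y

  ι-x : ι x ≡ fromℕ n
  ι-x with x ≟ x
  ... | yes _   = refl
  ... | no x≢x = contradiction refl x≢x

  ι-≢ : ∀ {y} → y ≢ x → ι y ≡ inject₁ y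
  ι-≢ {y} y≢x with y ≟ x
  ... | yes y≡x = contradiction y≡x y≢x
  ... | no _    = refl

  ι≡inject₁ : ∀ {y z} → ι y ≡ inject₁ z → y ≡ z × z ≢ x
  ι≡inject₁ {y} eq with y ≟ x
  ... | yes _   = contradiction eq fromℕ≢inject₁
  ... | no y≢x = inject₁-injective eq , λ { refl → y≢x (inject₁-injective eq) }

  ι≡fromℕ : ∀ {y} → ι y ≡ fromℕ n → y ≡ x
  ι≡fromℕ {y} eq with y ≟ x
  ... | yes y≡x = y≡x
  ... | no _    = contradiction (≡.sym eq) fromℕ≢inject₁

  𝒞′ : List (Subset (suc n))
  𝒞′ = image inject₁ C₁ ∷ List.map (image ι) R

  G′ : Graph (suc n)
  G′ = graphCoveredBy 𝒞′

  module _ {C : Subset n} where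

    inject₁∈image-inject₁⁻ : ∀ {y} → inject₁ y ∈ image inject₁ C → y ∈ C
    inject₁∈image-inject₁⁻ y∈ = let _ , a∈ , eq = ∈-image⁻ inject₁ y∈ in ≡.subst (_∈ C) (inject₁-injective eq) a∈

    fromℕ∉image-inject₁ : fromℕ n ∉ image inject₁ C
    fromℕ∉image-inject₁ w∈ = let _ , _ , eq = ∈-image⁻ inject₁ w∈ in fromℕ≢inject₁ (≡.sym eq)

    inject₁∈image-ι⁻ : ∀ {y} → inject₁ y ∈ image ι C → y ∈ C × y ≢ x
    inject₁∈image-ι⁻ y∈ = let _ , a∈ , eq = ∈-image⁻ ι y∈ ; a≡y , y≢x = ι≡inject₁ eq in
                          ≡.subst (_∈ C) a≡y a∈ , y≢x

    inject₁∈image-ι⁺ : ∀ {y} → y ≢ x → y ∈ C → inject₁ y ∈ image ι C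
    inject₁∈image-ι⁺ y≢x y∈ = ≡.subst (_∈ image ι C) (ι-≢ y≢x) (∈-image⁺ ι y∈)

    fromℕ∈image-ι⁻ : fromℕ n ∈ image ι C → x ∈ C
    fromℕ∈image-ι⁻ w∈ = let _ , a∈ , eq = ∈-image⁻ ι w∈ in ≡.subst (_∈ C) (ι≡fromℕ eq) a∈

    fromℕ∈image-ι⁺ : x ∈ C → fromℕ n ∈ image ι C
    fromℕ∈image-ι⁺ x∈ = ≡.subst (_∈ image ι C) ι-x (∈-image⁺ ι x∈)

  old-together⁻ : ∀ {y z} → Together 𝒞′ (inject₁ y) (inject₁ z) → Together (C₁ ∷ R) y z
  old-together⁻ (_ , here refl , y∈ , z∈) = C₁ , here refl , inject₁∈image-inject₁⁻ y∈ , inject₁∈image-inject₁⁻ z∈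
  old-together⁻ (_ , there C′∈ , y∈ , z∈) with ∈-map⁻ (image ι) C′∈
  ... | C , C∈ , refl = C , there C∈ , proj₁ (inject₁∈image-ι⁻ y∈) , proj₁ (inject₁∈image-ι⁻ z∈)

  old-together⁺ : ∀ {y z} → y ≢ x → z ≢ x → Together (C₁ ∷ R) y z → Together 𝒞′ (inject₁ y) (inject₁ z)
  old-together⁺ _ _ (_ , here refl , y∈ , z∈) =
    image inject₁ C₁ , here refl , ∈-image⁺ inject₁ y∈ , ∈-image⁺ inject₁ z∈
  old-together⁺ y≢x z≢x (C , there C∈ , y∈ , z∈) =
    image ι C , there (∈-map⁺ (image ι) C∈) , inject₁∈image-ι⁺ y≢x y∈ , inject₁∈image-ι⁺ z≢x z∈

  new-together⁻ : ∀ {z} → Together 𝒞′ (fromℕ n) (inject₁ z) → Together (C₁ ∷ R) x z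
  new-together⁻ (_ , here refl , w∈ , _) = contradiction w∈ fromℕ∉image-inject₁
  new-together⁻ (_ , there C′∈ , w∈ , z∈) with ∈-map⁻ (image ι) C′∈
  ... | C , C∈ , refl = C , there C∈ , fromℕ∈image-ι⁻ w∈ , proj₁ (inject₁∈image-ι⁻ z∈)

  isSplit : IsSplit G x G′
  isSplit = record { keep = keep ; nbrs = nbrs ; vw = vw }
    where
    keep : ∀ y z → y ≢ x → z ≢ x → adj G′ (inject₁ y) (inject₁ z) ≡ adj G y z
    keep y z y≢x z≢x = ⇔→≡ (mk⇔
      (λ e → let y≢z , t = graphCoveredBy-Edge⁻ {𝒞 = 𝒞′} e in
             Linked⇒Edge {G = G} cover (y≢z ∘ cong inject₁ , old-together⁻ t))
      (λ e → graphCoveredBy-Edge⁺ {𝒞 = 𝒞′} (Edge-irrefl G e ∘ inject₁-injective)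
                                            (old-together⁺ y≢x z≢x (proj₂ cover y z e))))
    nbrs : ∀ z → z ≢ x → (adj G′ (inject₁ x) (inject₁ z) ∨ adj G′ (fromℕ n) (inject₁ z)) ≡ adj G x z
    nbrs z z≢x = ⇔→≡ (mk⇔ to from)
      where
      x≢z : x ≢ z
      x≢z = z≢x ∘ ≡.sym
      to : adj G′ (inject₁ x) (inject₁ z) ∨ adj G′ (fromℕ n) (inject₁ z) ≡ true → Edge G x z
      to e with ∨-true⁻ e
      ... | inj₁ e′ = Linked⇒Edge {G = G} cover (x≢z , old-together⁻ (proj₂ (graphCoveredBy-Edge⁻ {𝒞 = 𝒞′} e′)))
      ... | inj₂ e′ = Linked⇒Edge {G = G} cover (x≢z , new-together⁻ (proj₂ (graphCoveredBy-Edge⁻ {𝒞 = 𝒞′} e′)))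
      from : Edge G x z → adj G′ (inject₁ x) (inject₁ z) ∨ adj G′ (fromℕ n) (inject₁ z) ≡ true
      from e with proj₂ cover x z e
      ... | _ , here refl , _ , z∈ = ∨-true⁺ (inj₁ (graphCoveredBy-Edge⁺ {𝒞 = 𝒞′} (x≢z ∘ inject₁-injective)
              (image inject₁ C₁ , here refl , ∈-image⁺ inject₁ x∈C₁ , ∈-image⁺ inject₁ z∈)))
      ... | C , there C∈ , x∈ , z∈ = ∨-true⁺ (inj₂ (graphCoveredBy-Edge⁺ {𝒞 = 𝒞′} fromℕ≢inject₁
              (image ι C , there (∈-map⁺ (image ι) C∈) , fromℕ∈image-ι⁺ x∈ , inject₁∈image-ι⁺ z≢x z∈)))
    vw : adj G′ (inject₁ x) (fromℕ n) ≡ false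
    vw = dec-false (linked? 𝒞′ (inject₁ x) (fromℕ n)) separated
      where
      separated : ¬ Linked 𝒞′ (inject₁ x) (fromℕ n)
      separated (_ , _ , here refl , _ , w∈) = fromℕ∉image-inject₁ w∈
      separated (_ , _ , there C′∈ , v∈ , _) with ∈-map⁻ (image ι) C′∈
      ... | C , _ , refl = proj₂ (inject₁∈image-ι⁻ v∈) refl

  weight′≤weight : weight 𝒞′ ≤ weight (C₁ ∷ R)
  weight′≤weight = +-mono-≤ (∣image∣≤∣p∣ inject₁ {C₁}) (weight-map-≤ (image ι) (λ C → ∣image∣≤∣p∣ ι {C}) R)

  ∣active∣<∣active′∣ : Large C₁ → ∀ {C₂} → C₂ ∈L R → x ∈ C₂ → Large C₂ → ∣ active G ∣ < ∣ active G′ ∣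
  ∣active∣<∣active′∣ large₁ {C₂} C₂∈ x∈C₂ large₂ = 1+∣q∣≤∣p∣ (active G′) (active G) old-active new-active
    where
    v-active : inject₁ x ∈ active G′
    v-active = let z , z∈ , z≢x = 2≤∣p∣⇒∃≢ large₁ x in
      ∈-active⁺ G′ (graphCoveredBy-Edge⁺ {𝒞 = 𝒞′} (z≢x ∘ ≡.sym ∘ inject₁-injective)
        (image inject₁ C₁ , here refl , ∈-image⁺ inject₁ x∈C₁ , ∈-image⁺ inject₁ z∈))
    new-active : fromℕ n ∈ active G′
    new-active = let z , z∈ , z≢x = 2≤∣p∣⇒∃≢ large₂ x in
      ∈-active⁺ G′ (graphCoveredBy-Edge⁺ {𝒞 = 𝒞′} fromℕ≢inject₁
        (image ι C₂ , there (∈-map⁺ (image ι) C₂∈) , fromℕ∈image-ι⁺ x∈C₂ , inject₁∈image-ι⁺ z≢x z∈))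
    old-active : ∀ {y} → y ∈ active G → inject₁ y ∈ active G′
    old-active {y} y∈ with y ≟ x
    ... | yes refl = v-active
    ... | no y≢x   = SplitProjection.inject₁-active isSplit y≢x y∈

sharedVertex⇒CVS : ∀ k {n} (G : Graph n) {𝒞 : List (Subset n)} {x} → IsSigmaCliqueCover G 𝒞 →
                   (∀ {C} → C ∈L 𝒞 → Large C) → weight 𝒞 ≤ ∣ active G ∣ + k → 2 ≤ occurrences 𝒞 x → CVS G k

SCC⇒CVS : ∀ k {n} (G : Graph n) → SCC G (∣ active G ∣ + k) → CVS G k
SCC⇒CVS k {n} G (𝒞 , cover , weight≤) with any? (λ x → 2 ≤? occurrences (large 𝒞) x)
... | yes (x , 2≤occ) = sharedVertex⇒CVS k G {x = x} (large-cover {G = G} {𝒞} cover) (∈-large⇒Large {𝒞 = 𝒞})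
                                         (≤-trans (weight-large 𝒞) weight≤) 2≤occ
... | no ∄2≤occ       = n , 0 , G , z≤n , done , cover⇒cluster {G = G} (large-cover {G = G} {𝒞} cover) occ≤1
  where
  occ≤1 : ∀ x → occurrences (large 𝒞) x ≤ 1
  occ≤1 x = ≤-pred (≰⇒> (∄2≤occ ∘ (x ,_)))

sharedVertex⇒CVS zero G {𝒞} {x} cover _ weight≤ 2≤occ =
  contradiction (<-≤-trans (∣active∣<weight {G = G} {𝒞} cover {x} 2≤occ)
                           (≤-trans weight≤ (≤-reflexive (+-identityʳ _))))
                (<-irrefl refl)
sharedVertex⇒CVS (suc k) G {𝒞} {x} cover all-large weight≤ 2≤occ with 2≤occurrences⇒↭ {x = x} 𝒞 2≤occ
... | C₁ , R , 𝒞↭ , x∈C₁ , C₂ , C₂∈ , x∈C₂ = lift (SCC⇒CVS k G′ (𝒞′ , graphCoveredBy-cover 𝒞′ , bound))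
  where
  open SplitAlong G x C₁ R (cover-↭ {G = G} 𝒞↭ cover) x∈C₁
  bound : weight 𝒞′ ≤ ∣ active G′ ∣ + k
  bound = begin
    weight 𝒞′             ≤⟨ weight′≤weight ⟩
    weight (C₁ ∷ R)       ≡⟨ weight-↭ 𝒞↭ ⟨
    weight 𝒞              ≤⟨ weight≤ ⟩
    ∣ active G ∣ + suc k  ≡⟨ +-suc ∣ active G ∣ k ⟩
    suc ∣ active G ∣ + k  ≤⟨ +-monoˡ-≤ k (∣active∣<∣active′∣ (all-large (∈-resp-↭ (↭-sym 𝒞↭) (here refl)))
                                          C₂∈ x∈C₂ (all-large (∈-resp-↭ (↭-sym 𝒞↭) (there C₂∈)))) ⟩
    ∣ active G′ ∣ + k     ∎
    where open ≤-Reasoning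
  lift : CVS G′ k → CVS G (suc k)
  lift (m , j , H , j≤k , splits , cluster) = m , suc j , H , s≤s j≤k , step x isSplit splits , cluster

lemma4 : ∀ n (G : Graph n) (k : ℕ) →
         (CVS G k → SCC G (n ∸ ∣ isolated G ∣ + k)) × (SCC G (n ∸ ∣ isolated G ∣ + k) → CVS G k)
lemma4 n G k rewrite ≡.sym (∣∁p∣≡n∸∣p∣ (isolated G)) = CVS⇒SCC G k , SCC⇒CVS k G
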